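{- Let $G$ be obtained from a graph $H$ by expanding a bisimplicial vertex of $H$. Then (i) $G$ is claw-free and matching covered if and only if $H$ is claw-free and matching covered; (ii) if $G$ is claw-free and matching covered, then $RE(G)=RE(H)$.
   Context: Graphs may have multiple edges but no loops. Matching covered: connected, at least two vertices, every edge in a perfect matching. Claw-free: no induced $K_{1,3}$. $RE(\cdot)$ is the set of removable edges (edges whose deletion leaves a matching covered graph). A vertex $x$ is bisimplicial if $N(x)$ induces two disjoint cliques each with at least two vertices. Expanding $x$: replace $x$ by two new vertices $x',x''$, join $x'$ to every vertex of one clique and $x''$ to every vertex of the other, and add an even path of length at least two with new internal vertices joining $x'$ and $x''$. Each edge of $H$ is identified with the corresponding edge of $G$ (an edge $xy$ of $H$ corresponds to $x'y$ or $x''y$). -}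

module Defs where

open import Data.Nat using (ℕ; zero; suc; _+_; _*_; _≤_)
open import Data.Fin using (Fin; zero; suc; _↑ˡ_; _↑ʳ_; splitAt; inject₁; fromℕ; _≟_)
open import Data.Bool using (Bool; true; false; if_then_else_)
open import Data.Product using (Σ; ∃; ∃-syntax; _×_; _,_; proj₁; proj₂)
open import Data.Sum using (_⊎_; inj₁; inj₂)
open import Data.Unit using (⊤)
open import Relation.Nullary using (¬_; yes; no)
open import Relation.Binary.PropositionalEquality using (_≡_; _≢_)

-- Finite multigraphs: vertices Fin n, edges Fin m, each edge has two ends.
-- Multiple edges are allowed (distinct edge indices with the same ends).

record Graph : Set where
  field
    n    : ℕ
    m    : ℕ
    ends : Fin m → Fin n × Fin n

open Graph public

Loopless : Graph → Set
Loopless G = ∀ e → proj₁ (ends G e) ≢ proj₂ (ends G e)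

Inc : (G : Graph) → Fin (n G) → Fin (m G) → Set
Inc G v e = proj₁ (ends G e) ≡ v ⊎ proj₂ (ends G e) ≡ v

Joins : (G : Graph) → Fin (m G) → Fin (n G) → Fin (n G) → Set
Joins G e u v = ends G e ≡ (u , v) ⊎ ends G e ≡ (v , u)

Adj : (G : Graph) → Fin (n G) → Fin (n G) → Set
Adj G u v = ∃[ e ] Joins G e u v

-- Spanning subgraphs are given by a predicate S on the edge set.
-- (G itself is S = λ _ → ⊤ ;  G - e is S = λ f → f ≢ e.)

EdgeSet : Graph → Set₁
EdgeSet G = Fin (m G) → Set

data Reach (G : Graph) (S : EdgeSet G) : Fin (n G) → Fin (n G) → Set where
  here : ∀ {u} → Reach G S u u
  step : ∀ {u w v} (e : Fin (m G)) → S e → Joins G e u w →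
         Reach G S w v → Reach G S u v

Connected : (G : Graph) → EdgeSet G → Set
Connected G S = ∀ u v → Reach G S u v

IsPerfectMatching : (G : Graph) → EdgeSet G → (Fin (m G) → Bool) → Set
IsPerfectMatching G S M =
  (∀ e → M e ≡ true → S e) ×
  (∀ v → ∃[ e ] (M e ≡ true × Inc G v e)) ×
  (∀ v e f → M e ≡ true → M f ≡ true → Inc G v e → Inc G v f → e ≡ f)

MatchingCoveredSub : (G : Graph) → EdgeSet G → Set
MatchingCoveredSub G S =
  Connected G S × 2 ≤ n G ×
  (∀ e → S e → ∃[ M ] (IsPerfectMatching G S M × M e ≡ true))

MatchingCovered : Graph → Set
MatchingCovered G = MatchingCoveredSub G (λ _ → ⊤)

Removable : (G : Graph) → Fin (m G) → Set
Removable G e = MatchingCoveredSub G (λ f → f ≢ e)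

ClawFree : Graph → Set
ClawFree G = ∀ (c a₁ a₂ a₃ : Fin (n G)) →
  ¬ ( c ≢ a₁ × c ≢ a₂ × c ≢ a₃ × a₁ ≢ a₂ × a₁ ≢ a₃ × a₂ ≢ a₃ ×
      Adj G c a₁ × Adj G c a₂ × Adj G c a₃ ×
      ¬ Adj G a₁ a₂ × ¬ Adj G a₁ a₃ × ¬ Adj G a₂ a₃ )

-- Bisimplicial vertex, with the two cliques given explicitly:
-- the neighbours v of x with side v ≡ true form one clique, those with
-- side v ≡ false the other; no edges between the two cliques; each clique
-- has at least two vertices.

BisimplicialWith : (H : Graph) → Fin (n H) → (Fin (n H) → Bool) → Set
BisimplicialWith H x side =
  (∀ u v → Adj H x u → Adj H x v → u ≢ v → side u ≡ side v → Adj H u v) ×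
  (∀ u v → Adj H x u → Adj H x v → side u ≢ side v → ¬ Adj H u v) ×
  (∃[ u ] ∃[ v ] (u ≢ v × Adj H x u × Adj H x v × side u ≡ true × side v ≡ true)) ×
  (∃[ u ] ∃[ v ] (u ≢ v × Adj H x u × Adj H x v × side u ≡ false × side v ≡ false))

Bisimplicial : (H : Graph) → Fin (n H) → Set
Bisimplicial H x = ∃[ side ] BisimplicialWith H x side

-- Expansion of x with path of even length pathLen k = 2k+2 (≥ 2).  The old vertex x plays the role
-- of x' (joined to the side-true clique); the new vertices
-- n H ↑ʳ j (j : Fin (pathLen k)) are the path vertices, the last one being
-- x'' (joined to the side-false clique).  The path is
-- x' = w 0, w 1, …, w (pathLen k) = x''.
-- Edges of G: Fin (m H + pathLen k); edge e ↑ˡ _ corresponds to edge e of H,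
-- edge m H ↑ʳ j is the j-th path edge.

pathLen : ℕ → ℕ
pathLen k = 2 + 2 * k

module Expansion (H : Graph) (x : Fin (n H)) (side : Fin (n H) → Bool) (k : ℕ) where

  V′ : ℕ
  V′ = n H + pathLen k

  x′ x″ : Fin V′
  x′ = x ↑ˡ pathLen k
  x″ = n H ↑ʳ fromℕ (suc (2 * k))

  -- image of end u of an edge whose other end is o
  rep : (o u : Fin (n H)) → Fin V′
  rep o u with u ≟ x
  ... | yes _ = if side o then x′ else x″
  ... | no  _ = u ↑ˡ pathLen k

  w : Fin (suc (pathLen k)) → Fin V′
  w zero    = x′
  w (suc j) = n H ↑ʳ j

  ends′ : Fin (m H + pathLen k) → Fin V′ × Fin V′
  ends′ f with splitAt (m H) f
  ... | inj₁ e = let (u , v) = ends H e in (rep v u , rep u v)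
  ... | inj₂ j = (w (inject₁ j) , w (suc j))

  G : Graph
  G = record { n = V′ ; m = m H + pathLen k ; ends = ends′ }

  edge : Fin (m H) → Fin (m G)
  edge e = e ↑ˡ pathLen k

  pathEdge : Fin (pathLen k) → Fin (m G)
  pathEdge j = m H ↑ʳ j

expand : (H : Graph) → Fin (n H) → (Fin (n H) → Bool) → ℕ → Graph
expand H x side k = Expansion.G H x side k

-- Away from x the expansion changes nothing, and near x it only splits x along its two
-- cliques. Hence claws correspond: a claw centred at x in H, or at x′ or a path vertex in G,
-- would need two independent vertices in one clique (or on the path), and any other claw is
-- carried between H and G by identifying the old vertices and contracting the path.
-- For matchings, the path x′ … x″ has an even number of edges, so every perfect matching of
-- G alternates along it and contains exactly one of its end edges; it therefore restricts to
-- a perfect matching of H, and a perfect matching of H extends to G once we choose which of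
-- x′, x″ inherits the matching edge at x. The same correspondence holds after deleting an
-- edge of H, giving RE(G) ∩ E(H) = RE(H), while no path edge is removable since matchings
-- through edges into x's two cliques use complementary sets of path edges.

module Submission where

open import Defs
open import Data.Nat using (ℕ; zero; suc; _+_; _*_; _≤_; s≤s; z≤n)
open import Data.Nat.Properties using (+-suc; ≤-trans; m≤n+m)
open import Data.Nat.GeneralisedArithmetic using (fold)
open import Data.Bool using (Bool; true; false; not; if_then_else_)
open import Data.Bool.Properties using (not-involutive; not-injective; not-¬; ¬-not) renaming (_≟_ to _≟ᵇ_)
open import Data.Fin using (Fin; zero; suc; _↑ˡ_; _↑ʳ_; splitAt; inject₁; fromℕ; toℕ; lower₁; _≟_)
open import Data.Fin.Properties
  using (splitAt-↑ˡ; splitAt-↑ʳ; splitAt⁻¹-↑ˡ; splitAt⁻¹-↑ʳ; ↑ˡ-injective; ↑ʳ-injective; suc-injective;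
         fromℕ≢inject₁; inject₁-injective; toℕ-inject₁; toℕ-fromℕ; toℕ-injective; inject₁-lower₁)
open import Data.Product using (∃-syntax; _×_; _,_; proj₁; proj₂)
open import Data.Product.Properties using (,-injectiveˡ; ,-injectiveʳ)
open import Data.Sum using (_⊎_; inj₁; inj₂; [_,_]′)
open import Data.Unit using (⊤; tt)
open import Data.Empty using (⊥; ⊥-elim)
open import Function.Base using (id; _∘_)
open import Function.Bundles using (_⇔_; mk⇔)
open import Relation.Nullary using (¬_; yes; no)
open import Relation.Binary.PropositionalEquality
  using (_≡_; _≢_; refl; sym; trans; cong; subst; subst₂; module ≡-Reasoning)

↑ˡ≢↑ʳ : ∀ {a b} (u : Fin a) (j : Fin b) → u ↑ˡ b ≢ a ↑ʳ j
↑ˡ≢↑ʳ {a} {b} u j eq with trans (sym (splitAt-↑ˡ a u b)) (trans (cong (splitAt a) eq) (splitAt-↑ʳ a b j))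
... | ()

inject₁≡zero⇒≡zero : ∀ {n} (j : Fin (suc n)) → inject₁ j ≡ zero → j ≡ zero
inject₁≡zero⇒≡zero zero _ = refl

inject₁≢suc : ∀ {n} (j : Fin n) → inject₁ j ≢ suc j
inject₁≢suc zero ()
inject₁≢suc (suc j) eq = inject₁≢suc j (suc-injective eq)

distinct⇒2≤ : ∀ {n} (a b : Fin n) → a ≢ b → 2 ≤ n
distinct⇒2≤ zero zero a≢b = ⊥-elim (a≢b refl)
distinct⇒2≤ {suc (suc n)} _ _ _ = s≤s (s≤s z≤n)
distinct⇒2≤ {suc zero} zero (suc ()) _
distinct⇒2≤ {suc zero} (suc ()) _ _

fold-not-not : ∀ n b → fold (not b) not n ≡ not (fold b not n)
fold-not-not zero b = refl
fold-not-not (suc n) b = cong not (fold-not-not n b)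

fold-not-even : ∀ n b → fold b not (2 * n) ≡ b
fold-not-even zero b = refl
fold-not-even (suc n) b rewrite +-suc n (n + 0) = trans (not-involutive _) (fold-not-even n b)

alternating⇒fold-not : ∀ n (s : Fin (suc n) → Bool) → (∀ (j : Fin n) → s (suc j) ≡ not (s (inject₁ j))) →
                       ∀ i → s i ≡ fold (s zero) not (toℕ i)
alternating⇒fold-not n s alt zero = refl
alternating⇒fold-not (suc n) s alt (suc j) =
  trans (alt j) (cong not (alternating⇒fold-not n (s ∘ inject₁) (alt ∘ inject₁) j))

three-in-two-classes : ∀ {A : Set} (P Q : A → Set) (D : A → A → Set) →
  (∀ {a b} → P a → P b → ¬ D a b) → (∀ {a b} → Q a → Q b → ¬ D a b) →
  ∀ {a₁ a₂ a₃} → D a₁ a₂ → D a₁ a₃ → D a₂ a₃ →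
  (P a₁ ⊎ Q a₁) → (P a₂ ⊎ Q a₂) → (P a₃ ⊎ Q a₃) → ⊥
three-in-two-classes P Q D cP cQ d₁₂ d₁₃ d₂₃ (inj₁ p₁) (inj₁ p₂) _         = cP p₁ p₂ d₁₂
three-in-two-classes P Q D cP cQ d₁₂ d₁₃ d₂₃ (inj₁ p₁) (inj₂ _)  (inj₁ p₃) = cP p₁ p₃ d₁₃
three-in-two-classes P Q D cP cQ d₁₂ d₁₃ d₂₃ (inj₁ _)  (inj₂ q₂) (inj₂ q₃) = cQ q₂ q₃ d₂₃
three-in-two-classes P Q D cP cQ d₁₂ d₁₃ d₂₃ (inj₂ q₁) (inj₂ q₂) _         = cQ q₁ q₂ d₁₂
three-in-two-classes P Q D cP cQ d₁₂ d₁₃ d₂₃ (inj₂ q₁) (inj₁ _)  (inj₂ q₃) = cQ q₁ q₃ d₁₃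
three-in-two-classes P Q D cP cQ d₁₂ d₁₃ d₂₃ (inj₂ _)  (inj₁ p₂) (inj₁ p₃) = cP p₂ p₃ d₂₃

module _ (K : Graph) where

  Joins-sym : ∀ {e u v} → Joins K e u v → Joins K e v u
  Joins-sym (inj₁ eq) = inj₂ eq
  Joins-sym (inj₂ eq) = inj₁ eq

  Adj-sym : ∀ {u v} → Adj K u v → Adj K v u
  Adj-sym (e , J) = e , Joins-sym J

  Joins⇒Inc : ∀ {e u v} → Joins K e u v → Inc K u e
  Joins⇒Inc (inj₁ eq) = inj₁ (cong proj₁ eq)
  Joins⇒Inc (inj₂ eq) = inj₂ (cong proj₂ eq)

  Inc⇒Joins : ∀ {u e} → Inc K u e → ∃[ v ] Joins K e u v
  Inc⇒Joins {e = e} (inj₁ eq) = proj₂ (ends K e) , inj₁ (cong (_, proj₂ (ends K e)) eq)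
  Inc⇒Joins {e = e} (inj₂ eq) = proj₁ (ends K e) , inj₂ (cong (proj₁ (ends K e) ,_) eq)

  Reach-trans : ∀ {S a b c} → Reach K S a b → Reach K S b c → Reach K S a c
  Reach-trans here r′ = r′
  Reach-trans (step e s J r) r′ = step e s J (Reach-trans r r′)

  Reach-sym : ∀ {S a b} → Reach K S a b → Reach K S b a
  Reach-sym here = here
  Reach-sym (step e s J r) = Reach-trans (Reach-sym r) (step e s (Joins-sym J) here)

  Reach-walk : ∀ {S} n (f : Fin (suc n) → Fin (Graph.n K)) →
    (∀ (j : Fin n) → Reach K S (f (inject₁ j)) (f (suc j))) → ∀ i → Reach K S (f zero) (f i)
  Reach-walk n f r zero = here
  Reach-walk (suc n) f r (suc j) = Reach-trans (Reach-walk n (f ∘ inject₁) (r ∘ inject₁) j) (r j)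

  MatchingCoveredSub-cong : ∀ {S T : EdgeSet K} → (∀ f → S f → T f) → (∀ f → T f → S f) →
                            MatchingCoveredSub K S → MatchingCoveredSub K T
  MatchingCoveredSub-cong {S} {T} S⊆T T⊆S (conn , two , cov) = (λ u v → reach (conn u v)) , two , cov′
    where
      reach : ∀ {u v} → Reach K S u v → Reach K T u v
      reach here = here
      reach (step e s J r) = step e (S⊆T e s) J (reach r)

      cov′ : ∀ e → T e → ∃[ M ] (IsPerfectMatching K T M × M e ≡ true)
      cov′ e t with cov e (T⊆S e t)
      ... | M , (M⊆S , covers , unique) , Me = M , ((λ f Mf → S⊆T f (M⊆S f Mf)) , covers , unique) , Me

  matched-elsewhere⇒unmatched : ∀ {S M p e f} → IsPerfectMatching K S M →
    M e ≡ true → Inc K p e → Inc K p f → e ≢ f → M f ≡ false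
  matched-elsewhere⇒unmatched {p = p} {e} {f} (_ , _ , unique) Me ie if e≢f =
    ¬-not (λ Mf → e≢f (unique p e f Me Mf ie if))

  Independent : Fin (n K) → Fin (n K) → Set
  Independent a b = a ≢ b × ¬ Adj K a b

  module _ (loopless : Loopless K) where

    Joins-irrefl : ∀ {e u v} → Joins K e u v → u ≢ v
    Joins-irrefl {e} (inj₁ p) u≡v = loopless e (trans (cong proj₁ p) (trans u≡v (sym (cong proj₂ p))))
    Joins-irrefl {e} (inj₂ p) u≡v = loopless e (trans (cong proj₁ p) (trans (sym u≡v) (sym (cong proj₂ p))))

    Adj-irrefl : ∀ {u v} → Adj K u v → u ≢ v
    Adj-irrefl (_ , J) = Joins-irrefl J

    Joins-functional : ∀ {e a u v} → Joins K e a u → Joins K e a v → u ≡ v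
    Joins-functional (inj₁ p) (inj₁ q) = ,-injectiveʳ (trans (sym p) q)
    Joins-functional (inj₂ p) (inj₂ q) = ,-injectiveˡ (trans (sym p) q)
    Joins-functional J@(inj₁ p) (inj₂ q) = ⊥-elim (Joins-irrefl J (sym (,-injectiveʳ (trans (sym p) q))))
    Joins-functional J@(inj₂ p) (inj₁ q) = ⊥-elim (Joins-irrefl J (sym (,-injectiveˡ (trans (sym p) q))))

module Expanded (H : Graph) (x : Fin (n H)) (side : Fin (n H) → Bool) (k : ℕ) where
  open Expansion H x side k

  -- x″ = n H ↑ʳ L = w (suc L).
  L : Fin (pathLen k)
  L = fromℕ (suc (2 * k))

  data VertexView : Fin V′ → Set where
    old  : ∀ u → VertexView (u ↑ˡ pathLen k)
    path : ∀ j → VertexView (n H ↑ʳ j)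

  vertexView : ∀ p → VertexView p
  vertexView p with splitAt (n H) p in eq
  ... | inj₁ u = subst VertexView (splitAt⁻¹-↑ˡ eq) (old u)
  ... | inj₂ j = subst VertexView (splitAt⁻¹-↑ʳ eq) (path j)

  data EdgeView : Fin (m G) → Set where
    hEdge : ∀ e → EdgeView (edge e)
    pEdge : ∀ j → EdgeView (pathEdge j)

  edgeView : ∀ f → EdgeView f
  edgeView f with splitAt (m H) f in eq
  ... | inj₁ e = subst EdgeView (splitAt⁻¹-↑ˡ eq) (hEdge e)
  ... | inj₂ j = subst EdgeView (splitAt⁻¹-↑ʳ eq) (pEdge j)

  edge≢pathEdge : ∀ e j → edge e ≢ pathEdge j
  edge≢pathEdge = ↑ˡ≢↑ʳ

  ends-edge : ∀ e → ends G (edge e) ≡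
    (rep (proj₂ (ends H e)) (proj₁ (ends H e)) , rep (proj₁ (ends H e)) (proj₂ (ends H e)))
  ends-edge e rewrite splitAt-↑ˡ (m H) e (pathLen k) = refl

  ends-pathEdge : ∀ j → ends G (pathEdge j) ≡ (w (inject₁ j) , w (suc j))
  ends-pathEdge j rewrite splitAt-↑ʳ (m H) (pathLen k) j = refl

  rep-x : ∀ o → rep o x ≡ (if side o then x′ else x″)
  rep-x o with x ≟ x
  ... | yes _ = refl
  ... | no x≢x = ⊥-elim (x≢x refl)

  rep-≢x : ∀ o {u} → u ≢ x → rep o u ≡ u ↑ˡ pathLen k
  rep-≢x o {u} u≢x with u ≟ x
  ... | yes u≡x = ⊥-elim (u≢x u≡x)
  ... | no _ = refl

  rep-x-true : ∀ {o} → side o ≡ true → rep o x ≡ x′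
  rep-x-true {o} s = trans (rep-x o) (cong (if_then x′ else x″) s)

  rep-x-false : ∀ {o} → side o ≡ false → rep o x ≡ x″
  rep-x-false {o} s = trans (rep-x o) (cong (if_then x′ else x″) s)

  data RepView (o u : Fin (n H)) : Set where
    rep-old : u ≢ x → rep o u ≡ u ↑ˡ pathLen k → RepView o u
    rep-x′  : u ≡ x → side o ≡ true  → rep o u ≡ x′ → RepView o u
    rep-x″  : u ≡ x → side o ≡ false → rep o u ≡ x″ → RepView o u

  repView : ∀ o u → RepView o u
  repView o u with u ≟ x
  ... | no u≢x = rep-old u≢x (rep-≢x o u≢x)
  ... | yes refl with side o in s
  ...   | true  = rep-x′ refl s (rep-x-true s)
  ...   | false = rep-x″ refl s (rep-x-false s)

  rep≡old : ∀ {o u v} → rep o u ≡ v ↑ˡ pathLen k → (u ≡ v) × (u ≡ x → side o ≡ true)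
  rep≡old {o} {u} {v} eq with repView o u
  ... | rep-old u≢x r = ↑ˡ-injective _ u v (trans (sym r) eq) , ⊥-elim ∘ u≢x
  ... | rep-x′ refl s r = ↑ˡ-injective _ x v (trans (sym r) eq) , λ _ → s
  ... | rep-x″ refl s r = ⊥-elim (↑ˡ≢↑ʳ v L (trans (sym eq) r))

  rep≡path : ∀ {o u j} → rep o u ≡ n H ↑ʳ j → (u ≡ x) × (side o ≡ false) × (j ≡ L)
  rep≡path {o} {u} {j} eq with repView o u
  ... | rep-old _ r = ⊥-elim (↑ˡ≢↑ʳ u j (trans (sym r) eq))
  ... | rep-x′ refl _ r = ⊥-elim (↑ˡ≢↑ʳ x j (trans (sym r) eq))
  ... | rep-x″ refl s r = refl , s , sym (↑ʳ-injective (n H) L j (trans (sym r) eq))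

  rep-injective : ∀ {o a b} → rep o a ≡ rep o b → a ≡ b
  rep-injective {o} {a} {b} eq with repView o b
  ... | rep-old _ r = proj₁ (rep≡old (trans eq r))
  ... | rep-x′ refl _ r = proj₁ (rep≡old (trans eq r))
  ... | rep-x″ refl _ r = proj₁ (rep≡path (trans eq r))

  w≡old : ∀ {i u} → w i ≡ u ↑ˡ pathLen k → (i ≡ zero) × (u ≡ x)
  w≡old {zero} eq = refl , sym (↑ˡ-injective _ x _ eq)
  w≡old {suc i} {u} eq = ⊥-elim (↑ˡ≢↑ʳ u i (sym eq))

  w≡path : ∀ {i j} → w i ≡ n H ↑ʳ j → i ≡ suc j
  w≡path {zero} {j} eq = ⊥-elim (↑ˡ≢↑ʳ x j eq)
  w≡path {suc i} {j} eq = cong suc (↑ʳ-injective (n H) i j eq)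

  collapse : Fin V′ → Fin (n H)
  collapse p = [ id , (λ _ → x) ]′ (splitAt (n H) p)

  collapse-old : ∀ u → collapse (u ↑ˡ pathLen k) ≡ u
  collapse-old u rewrite splitAt-↑ˡ (n H) u (pathLen k) = refl

  collapse-w : ∀ i → collapse (w i) ≡ x
  collapse-w zero = collapse-old x
  collapse-w (suc j) rewrite splitAt-↑ʳ (n H) (pathLen k) j = refl

  collapse-rep : ∀ o u → collapse (rep o u) ≡ u
  collapse-rep o u with repView o u
  ... | rep-old _ r = trans (cong collapse r) (collapse-old u)
  ... | rep-x′ refl _ r = trans (cong collapse r) (collapse-old x)
  ... | rep-x″ refl _ r = trans (cong collapse r) (collapse-w (suc L))

  Joins-edge : ∀ {e u v} → Joins H e u v → Joins G (edge e) (rep v u) (rep u v)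
  Joins-edge {e} (inj₁ eq) = inj₁ (trans (ends-edge e) (cong (λ (a , b) → rep b a , rep a b) eq))
  Joins-edge {e} (inj₂ eq) = inj₂ (trans (ends-edge e) (cong (λ (a , b) → rep b a , rep a b) eq))

  Joins-edge⁻ : ∀ {e p q} → Joins G (edge e) p q →
    ∃[ u ] ∃[ v ] (Joins H e u v × p ≡ rep v u × q ≡ rep u v)
  Joins-edge⁻ {e} (inj₁ eq) = _ , _ , inj₁ refl , sym (,-injectiveˡ eq′) , sym (,-injectiveʳ eq′)
    where eq′ = trans (sym (ends-edge e)) eq
  Joins-edge⁻ {e} (inj₂ eq) = _ , _ , inj₂ refl , sym (,-injectiveʳ eq′) , sym (,-injectiveˡ eq′)
    where eq′ = trans (sym (ends-edge e)) eq

  Joins-pathEdge : ∀ j → Joins G (pathEdge j) (w (inject₁ j)) (w (suc j))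
  Joins-pathEdge j = inj₁ (ends-pathEdge j)

  Joins-pathEdge⁻ : ∀ {j p q} → Joins G (pathEdge j) p q →
    (p ≡ w (inject₁ j) × q ≡ w (suc j)) ⊎ (p ≡ w (suc j) × q ≡ w (inject₁ j))
  Joins-pathEdge⁻ {j} (inj₁ eq) = inj₁ (sym (,-injectiveˡ eq′) , sym (,-injectiveʳ eq′))
    where eq′ = trans (sym (ends-pathEdge j)) eq
  Joins-pathEdge⁻ {j} (inj₂ eq) = inj₂ (sym (,-injectiveʳ eq′) , sym (,-injectiveˡ eq′))
    where eq′ = trans (sym (ends-pathEdge j)) eq

  Inc-edge : ∀ {e u v} → Joins H e u v → Inc G (rep v u) (edge e)
  Inc-edge J = Joins⇒Inc G (Joins-edge J)

  Inc-x′ : ∀ {e a} → Joins H e x a → side a ≡ true → Inc G x′ (edge e)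
  Inc-x′ {e} J s = subst (λ p → Inc G p (edge e)) (rep-x-true s) (Inc-edge J)

  Inc-x″ : ∀ {e a} → Joins H e x a → side a ≡ false → Inc G x″ (edge e)
  Inc-x″ {e} J s = subst (λ p → Inc G p (edge e)) (rep-x-false s) (Inc-edge J)

  Inc-old : ∀ {u e} → u ≢ x → Inc H u e → Inc G (u ↑ˡ pathLen k) (edge e)
  Inc-old {u} {e} u≢x i with Inc⇒Joins H i
  ... | o , J = subst (λ p → Inc G p (edge e)) (rep-≢x o u≢x) (Inc-edge J)

  Inc-x : ∀ {e} → Inc H x e → Inc G x′ (edge e) ⊎ Inc G x″ (edge e)
  Inc-x i with Inc⇒Joins H i
  ... | o , J with side o in s
  ...   | true  = inj₁ (Inc-x′ J s)
  ...   | false = inj₂ (Inc-x″ J s)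

  Inc-pathEdge-start : ∀ j → Inc G (w (inject₁ j)) (pathEdge j)
  Inc-pathEdge-start j = Joins⇒Inc G (Joins-pathEdge j)

  Inc-pathEdge-end : ∀ j → Inc G (w (suc j)) (pathEdge j)
  Inc-pathEdge-end j = Joins⇒Inc G (Joins-sym G (Joins-pathEdge j))

  Inc-edge⁻ : ∀ {e p} → Inc G p (edge e) → ∃[ u ] ∃[ v ] (Joins H e u v × p ≡ rep v u)
  Inc-edge⁻ i with Joins-edge⁻ (proj₂ (Inc⇒Joins G i))
  ... | u , v , J , p≡ , _ = u , v , J , p≡

  Inc-pathEdge⁻ : ∀ {j p} → Inc G p (pathEdge j) → p ≡ w (inject₁ j) ⊎ p ≡ w (suc j)
  Inc-pathEdge⁻ i with Joins-pathEdge⁻ (proj₂ (Inc⇒Joins G i))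
  ... | inj₁ (p≡ , _) = inj₁ p≡
  ... | inj₂ (p≡ , _) = inj₂ p≡

  Inc-old⁻ : ∀ {u f} → u ≢ x → Inc G (u ↑ˡ pathLen k) f → ∃[ e ] (f ≡ edge e × Inc H u e)
  Inc-old⁻ {u} {f} u≢x i with edgeView f
  ... | hEdge e with Inc-edge⁻ i
  ...   | a , b , J , eq with rep≡old {b} {a} {u} (sym eq)
  ...     | refl , _ = e , refl , Joins⇒Inc H J
  Inc-old⁻ {u} {f} u≢x i | pEdge j with Inc-pathEdge⁻ i
  ... | inj₁ eq = ⊥-elim (u≢x (proj₂ (w≡old {inject₁ j} (sym eq))))
  ... | inj₂ eq = ⊥-elim (u≢x (proj₂ (w≡old {suc j} (sym eq))))

  Inc-x′⁻ : ∀ {f} → Inc G x′ f →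
    (∃[ e ] (f ≡ edge e × ∃[ o ] (Joins H e x o × side o ≡ true))) ⊎ f ≡ pathEdge zero
  Inc-x′⁻ {f} i with edgeView f
  ... | hEdge e with Inc-edge⁻ i
  ...   | a , o , J , eq with rep≡old {o} {a} {x} (sym eq)
  ...     | refl , s = inj₁ (e , refl , o , J , s refl)
  Inc-x′⁻ {f} i | pEdge j with Inc-pathEdge⁻ i
  ... | inj₁ eq = inj₂ (cong pathEdge (inject₁≡zero⇒≡zero j (proj₁ (w≡old {inject₁ j} (sym eq)))))
  ... | inj₂ eq with proj₁ (w≡old {suc j} (sym eq))
  ...   | ()

  Inc-path⁻ : ∀ {j f} → Inc G (n H ↑ʳ j) f →
    (∃[ e ] (f ≡ edge e × j ≡ L × ∃[ o ] (Joins H e x o × side o ≡ false)))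
    ⊎ (f ≡ pathEdge j) ⊎ (∃[ i ] (j ≡ inject₁ i × f ≡ pathEdge (suc i)))
  Inc-path⁻ {j} {f} i with edgeView f
  ... | hEdge e with Inc-edge⁻ i
  ...   | a , o , J , eq with rep≡path {o} {a} {j} (sym eq)
  ...     | refl , s , j≡L = inj₁ (e , refl , j≡L , o , J , s)
  Inc-path⁻ {j} {f} i | pEdge i′ with Inc-pathEdge⁻ i
  ... | inj₂ eq = inj₂ (inj₁ (cong pathEdge (suc-injective (w≡path {suc i′} (sym eq)))))
  Inc-path⁻ {j} {f} i | pEdge zero     | inj₁ eq = ⊥-elim (↑ˡ≢↑ʳ x j (sym eq))
  Inc-path⁻ {j} {f} i | pEdge (suc i′) | inj₁ eq = inj₂ (inj₂ (i′ , ↑ʳ-injective (n H) j _ eq , refl))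

  module PathParity {S : EdgeSet G} {M : Fin (m G) → Bool} (pm : IsPerfectMatching G S M) where
    private
      covers = proj₁ (proj₂ pm)
      unique = proj₂ (proj₂ pm)

    pathEdges-alternate : ∀ (j : Fin (suc (2 * k))) → M (pathEdge (suc j)) ≡ not (M (pathEdge (inject₁ j)))
    pathEdges-alternate j with M (pathEdge (inject₁ j)) in Mj
    ... | true = matched-elsewhere⇒unmatched G pm Mj (Inc-pathEdge-end (inject₁ j)) (Inc-pathEdge-start (suc j))
                   (inject₁≢suc j ∘ ↑ʳ-injective (m H) _ _)
    ... | false with covers (n H ↑ʳ inject₁ j)
    ...   | f , Mf , i with Inc-path⁻ {inject₁ j} i
    ...     | inj₁ (_ , _ , j≡L , _) = ⊥-elim (fromℕ≢inject₁ (sym j≡L))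
    ...     | inj₂ (inj₁ refl) = ⊥-elim (not-¬ refl (trans (sym Mf) Mj))
    ...     | inj₂ (inj₂ (i′ , eq , refl)) with inject₁-injective eq
    ...       | refl = Mf

    pathEdge-parity : ∀ i → M (pathEdge i) ≡ fold (M (pathEdge zero)) not (toℕ i)
    pathEdge-parity = alternating⇒fold-not (suc (2 * k)) (M ∘ pathEdge) pathEdges-alternate

    -- The path from x′ to x″ has an even number of edges, so M contains exactly one of its end edges.
    lastPathEdge : M (pathEdge L) ≡ not (M (pathEdge zero))
    lastPathEdge = begin
      M (pathEdge L)                             ≡⟨ pathEdge-parity L ⟩
      fold (M (pathEdge zero)) not (toℕ L)       ≡⟨ cong (fold _ not) (toℕ-fromℕ (suc (2 * k))) ⟩
      not (fold (M (pathEdge zero)) not (2 * k)) ≡⟨ cong not (fold-not-even k _) ⟩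
      not (M (pathEdge zero))                    ∎
      where open ≡-Reasoning

    ¬x′x″-matched-off-path : ∀ {e f} → M (edge e) ≡ true → M (edge f) ≡ true →
                             Inc G x′ (edge e) → Inc G x″ (edge f) → ⊥
    ¬x′x″-matched-off-path {e} {f} Me Mf ie if = not-¬ (sym first) (trans (sym last) lastPathEdge)
      where
        first : M (pathEdge zero) ≡ false
        first = matched-elsewhere⇒unmatched G pm Me ie (Inc-pathEdge-start zero) (edge≢pathEdge e zero)
        last : M (pathEdge L) ≡ false
        last = matched-elsewhere⇒unmatched G pm Mf if (Inc-pathEdge-end L) (edge≢pathEdge f L)

  withPath : EdgeSet H → EdgeSet G
  withPath S f = [ S , (λ _ → ⊤) ]′ (splitAt (m H) f)

  withPath-edge⁺ : ∀ {S e} → S e → withPath S (edge e)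
  withPath-edge⁺ {e = e} s rewrite splitAt-↑ˡ (m H) e (pathLen k) = s

  withPath-edge⁻ : ∀ {S e} → withPath S (edge e) → S e
  withPath-edge⁻ {e = e} s rewrite splitAt-↑ˡ (m H) e (pathLen k) = s

  withPath-pathEdge : ∀ {S} j → withPath S (pathEdge j)
  withPath-pathEdge j rewrite splitAt-↑ʳ (m H) (pathLen k) j = tt

  withPath-all : ∀ f → withPath (λ _ → ⊤) f
  withPath-all f with edgeView f
  ... | hEdge e = withPath-edge⁺ tt
  ... | pEdge j = withPath-pathEdge j

  withPath-avoiding⁺ : ∀ e f → f ≢ edge e → withPath (λ g → g ≢ e) f
  withPath-avoiding⁺ e f f≢e with edgeView f
  ... | hEdge e′ = withPath-edge⁺ (f≢e ∘ cong edge)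
  ... | pEdge j = withPath-pathEdge j

  withPath-avoiding⁻ : ∀ e f → withPath (λ g → g ≢ e) f → f ≢ edge e
  withPath-avoiding⁻ e f s with edgeView f
  ... | hEdge e′ = withPath-edge⁻ s ∘ ↑ˡ-injective _ e′ e
  ... | pEdge j = edge≢pathEdge e j ∘ sym

  restrict-perfect : ∀ {S M} → IsPerfectMatching G (withPath S) M → IsPerfectMatching H S (M ∘ edge)
  restrict-perfect {S} {M} pm@(M⊆S , covers , unique) =
    (λ e Me → withPath-edge⁻ (M⊆S (edge e) Me)) , covers′ , unique′
    where
      open PathParity pm

      covers′ : ∀ u → ∃[ e ] (M (edge e) ≡ true × Inc H u e)
      covers′ u with u ≟ x
      ... | no u≢x with covers (u ↑ˡ pathLen k)
      ...   | f , Mf , i with Inc-old⁻ u≢x i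
      ...     | e , refl , ih = e , Mf , ih
      covers′ u | yes refl with M (pathEdge zero) in M₀
      ... | false with covers x′
      ...   | f , Mf , i with Inc-x′⁻ i
      ...     | inj₁ (e , refl , _ , J , _) = e , Mf , Joins⇒Inc H J
      ...     | inj₂ refl = ⊥-elim (not-¬ Mf M₀)
      covers′ u | yes refl | true with covers x″
      ...   | f , Mf , i with Inc-path⁻ {L} i
      ...     | inj₁ (e , refl , _ , _ , J , _) = e , Mf , Joins⇒Inc H J
      ...     | inj₂ (inj₁ refl) = ⊥-elim (not-¬ Mf (trans lastPathEdge (cong not M₀)))
      ...     | inj₂ (inj₂ (_ , L≡ , _)) = ⊥-elim (fromℕ≢inject₁ L≡)

      unique′ : ∀ u e f → M (edge e) ≡ true → M (edge f) ≡ true → Inc H u e → Inc H u f → e ≡ f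
      unique′ u e f Me Mf ie if with u ≟ x
      ... | no u≢x = ↑ˡ-injective _ e f (unique _ _ _ Me Mf (Inc-old u≢x ie) (Inc-old u≢x if))
      ... | yes refl with Inc-x ie | Inc-x if
      ...   | inj₁ a | inj₁ b = ↑ˡ-injective _ e f (unique x′ _ _ Me Mf a b)
      ...   | inj₂ a | inj₂ b = ↑ˡ-injective _ e f (unique x″ _ _ Me Mf a b)
      ...   | inj₁ a | inj₂ b = ⊥-elim (¬x′x″-matched-off-path Me Mf a b)
      ...   | inj₂ a | inj₁ b = ⊥-elim (¬x′x″-matched-off-path Mf Me b a)

  -- t says whether x′ (true) or x″ (false) inherits the matching edge at x;
  -- the path edges are then taken alternately so as to cover the other one.
  extendMatching : (Fin (m H) → Bool) → Bool → Fin (m G) → Bool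
  extendMatching Mh t f = [ Mh , (λ j → fold (not t) not (toℕ j)) ]′ (splitAt (m H) f)

  module Extension (loopless : Loopless H) {S : EdgeSet H} {Mh : Fin (m H) → Bool}
                   (pmh : IsPerfectMatching H S Mh)
                   {e₀ o₀} (Me₀ : Mh e₀ ≡ true) (J₀ : Joins H e₀ x o₀) where
    private
      Mh⊆S = proj₁ pmh
      coversH = proj₁ (proj₂ pmh)
      uniqueH = proj₂ (proj₂ pmh)

    t : Bool
    t = side o₀

    M : Fin (m G) → Bool
    M = extendMatching Mh t

    M-edge : ∀ e → M (edge e) ≡ Mh e
    M-edge e rewrite splitAt-↑ˡ (m H) e (pathLen k) = refl

    M-pathEdge : ∀ j → M (pathEdge j) ≡ fold (not t) not (toℕ j)
    M-pathEdge j rewrite splitAt-↑ʳ (m H) (pathLen k) j = refl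

    M-pathEdge-inject₁ : ∀ i → M (pathEdge (inject₁ i)) ≡ fold (not t) not (toℕ i)
    M-pathEdge-inject₁ i = trans (M-pathEdge (inject₁ i)) (cong (fold (not t) not) (toℕ-inject₁ i))

    M-lastPathEdge : M (pathEdge L) ≡ t
    M-lastPathEdge = begin
      M (pathEdge L)                   ≡⟨ M-pathEdge L ⟩
      fold (not t) not (toℕ L)         ≡⟨ cong (fold (not t) not) (toℕ-fromℕ (suc (2 * k))) ⟩
      not (fold (not t) not (2 * k))   ≡⟨ cong not (fold-not-even k (not t)) ⟩
      not (not t)                      ≡⟨ not-involutive t ⟩
      t                                ∎
      where open ≡-Reasoning

    ¬consecutive : ∀ i → M (pathEdge (inject₁ i)) ≡ true → M (pathEdge (suc i)) ≡ true → ⊥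
    ¬consecutive i Mi Msi = not-¬ (sym (trans (sym (M-pathEdge-inject₁ i)) Mi)) (sym (trans (sym (M-pathEdge (suc i))) Msi))

    M⊆withPath : ∀ f → M f ≡ true → withPath S f
    M⊆withPath f Mf with edgeView f
    ... | hEdge e = withPath-edge⁺ (Mh⊆S e (trans (sym (M-edge e)) Mf))
    ... | pEdge j = withPath-pathEdge j

    x-matched-by-e₀ : ∀ {e o} → Mh e ≡ true → Joins H e x o → (e ≡ e₀) × (side o ≡ t)
    x-matched-by-e₀ Me J with uniqueH x _ _ Me Me₀ (Joins⇒Inc H J) (Joins⇒Inc H J₀)
    ... | refl = refl , cong side (Joins-functional H loopless J J₀)

    coversX′ : ∀ b → side o₀ ≡ b → ∃[ f ] (M f ≡ true × Inc G x′ f)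
    coversX′ true  s = edge e₀ , trans (M-edge e₀) Me₀ , Inc-x′ J₀ s
    coversX′ false s = pathEdge zero , trans (M-pathEdge zero) (cong not s) , Inc-pathEdge-start zero

    coversX″ : ∀ b → side o₀ ≡ b → ∃[ f ] (M f ≡ true × Inc G x″ f)
    coversX″ true  s = pathEdge L , trans M-lastPathEdge s , Inc-pathEdge-end L
    coversX″ false s = edge e₀ , trans (M-edge e₀) Me₀ , Inc-x″ J₀ s

    coversInner : ∀ i → ∃[ f ] (M f ≡ true × Inc G (n H ↑ʳ inject₁ i) f)
    coversInner i with fold (not t) not (toℕ i) in Mi
    ... | true  = pathEdge (inject₁ i) , trans (M-pathEdge-inject₁ i) Mi , Inc-pathEdge-end (inject₁ i)
    ... | false = pathEdge (suc i) , trans (M-pathEdge (suc i)) (cong not Mi) , Inc-pathEdge-start (suc i)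

    covers : ∀ p → ∃[ f ] (M f ≡ true × Inc G p f)
    covers p with vertexView p
    ... | old u with u ≟ x
    ...   | yes refl = coversX′ t refl
    ...   | no u≢x with coversH u
    ...     | e , Me , i = edge e , trans (M-edge e) Me , Inc-old u≢x i
    covers p | path j with j ≟ L
    ... | yes refl = coversX″ t refl
    ... | no j≢L = subst (λ j → ∃[ f ] (M f ≡ true × Inc G (n H ↑ʳ j) f))
                         (inject₁-lower₁ j ≢toℕ) (coversInner (lower₁ j ≢toℕ))
      where
        ≢toℕ : suc (2 * k) ≢ toℕ j
        ≢toℕ eq = j≢L (toℕ-injective (trans (sym eq) (sym (toℕ-fromℕ _))))

    data MatchedAtX′ (f : Fin (m G)) : Set where
      byE₀   : f ≡ edge e₀ → t ≡ true → MatchedAtX′ f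
      byPath : f ≡ pathEdge zero → t ≡ false → MatchedAtX′ f

    matchedAtX′ : ∀ {f} → M f ≡ true → Inc G x′ f → MatchedAtX′ f
    matchedAtX′ Mf i with Inc-x′⁻ i
    ... | inj₁ (e , refl , o , J , s) with x-matched-by-e₀ (trans (sym (M-edge e)) Mf) J
    ...   | refl , so = byE₀ refl (trans (sym so) s)
    matchedAtX′ Mf i | inj₂ refl = byPath refl (not-injective {y = false} (trans (sym (M-pathEdge zero)) Mf))

    data MatchedAtPath (j : Fin (pathLen k)) (f : Fin (m G)) : Set where
      byE₀     : f ≡ edge e₀ → j ≡ L → t ≡ false → MatchedAtPath j f
      backward : f ≡ pathEdge j → MatchedAtPath j f
      forward  : ∀ i → j ≡ inject₁ i → f ≡ pathEdge (suc i) → MatchedAtPath j f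

    matchedAtPath : ∀ {j f} → M f ≡ true → Inc G (n H ↑ʳ j) f → MatchedAtPath j f
    matchedAtPath Mf i with Inc-path⁻ i
    ... | inj₁ (e , refl , j≡L , o , J , s) with x-matched-by-e₀ (trans (sym (M-edge e)) Mf) J
    ...   | refl , so = byE₀ refl j≡L (trans (sym so) s)
    matchedAtPath Mf i | inj₂ (inj₁ eq) = backward eq
    matchedAtPath Mf i | inj₂ (inj₂ (i′ , eq , eq′)) = forward i′ eq eq′

    ¬byE₀-backward : ∀ {j} → j ≡ L → t ≡ false → M (pathEdge j) ≡ true → ⊥
    ¬byE₀-backward refl t≡false Mj = not-¬ (trans (sym Mj) M-lastPathEdge) (sym (cong not t≡false))

    ¬backward-forward : ∀ {j} i → j ≡ inject₁ i → M (pathEdge j) ≡ true → M (pathEdge (suc i)) ≡ true → ⊥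
    ¬backward-forward i refl = ¬consecutive i

    unique : ∀ p f g → M f ≡ true → M g ≡ true → Inc G p f → Inc G p g → f ≡ g
    unique p f g Mf Mg if ig with vertexView p
    ... | old u with u ≟ x
    ...   | no u≢x with Inc-old⁻ u≢x if | Inc-old⁻ u≢x ig
    ...     | e , refl , ie | e′ , refl , ie′ =
              cong edge (uniqueH u e e′ (trans (sym (M-edge e)) Mf) (trans (sym (M-edge e′)) Mg) ie ie′)
    unique p f g Mf Mg if ig | old u | yes refl with matchedAtX′ Mf if | matchedAtX′ Mg ig
    ... | byE₀ a _   | byE₀ b _   = trans a (sym b)
    ... | byPath a _ | byPath b _ = trans a (sym b)
    ... | byE₀ _ s   | byPath _ s′ = ⊥-elim (not-¬ s s′)
    ... | byPath _ s′ | byE₀ _ s  = ⊥-elim (not-¬ s s′)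
    unique p f g Mf Mg if ig | path j with matchedAtPath Mf if | matchedAtPath Mg ig
    ... | byE₀ a _ _   | byE₀ b _ _   = trans a (sym b)
    ... | backward a   | backward b   = trans a (sym b)
    ... | byE₀ _ j≡L t≡f | backward refl = ⊥-elim (¬byE₀-backward j≡L t≡f Mg)
    ... | backward refl | byE₀ _ j≡L t≡f = ⊥-elim (¬byE₀-backward j≡L t≡f Mf)
    ... | byE₀ _ j≡L _ | forward i a _ = ⊥-elim (fromℕ≢inject₁ (trans (sym j≡L) a))
    ... | forward i a _ | byE₀ _ j≡L _ = ⊥-elim (fromℕ≢inject₁ (trans (sym j≡L) a))
    ... | backward refl | forward i a refl = ⊥-elim (¬backward-forward i a Mf Mg)
    ... | forward i a refl | backward refl = ⊥-elim (¬backward-forward i a Mg Mf)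
    ... | forward i a a′ | forward i′ b b′ with inject₁-injective (trans (sym a) b)
    ...   | refl = trans a′ (sym b′)

    perfect : IsPerfectMatching G (withPath S) M
    perfect = M⊆withPath , covers , unique

  SideEdge : EdgeSet H → Bool → Set
  SideEdge S b = ∃[ e ] ∃[ a ] (S e × Joins H e x a × side a ≡ b)

  -- A perfect matching through an H-edge at x′ and one through an H-edge at x″ alternate
  -- along the path with opposite phases, so one of them uses any given path edge.
  pathEdge-notRemovable : SideEdge (λ _ → ⊤) true → SideEdge (λ _ → ⊤) false →
                          ∀ j → ¬ Removable G (pathEdge j)
  pathEdge-notRemovable (eA , a , _ , JA , sA) (eB , b , _ , JB , sB) j (_ , _ , cov)
    with cov (edge eA) (edge≢pathEdge eA j) | cov (edge eB) (edge≢pathEdge eB j)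
  ... | M₁ , pm₁ , M₁eA | M₂ , pm₂ , M₂eB = not-¬ parity₁ parity₂
    where
      avoids : ∀ {M} → IsPerfectMatching G (λ f → f ≢ pathEdge j) M → M (pathEdge j) ≡ false
      avoids pm = ¬-not (λ Mj → proj₁ pm (pathEdge j) Mj refl)

      M₁-first : M₁ (pathEdge zero) ≡ false
      M₁-first = matched-elsewhere⇒unmatched G pm₁ M₁eA (Inc-x′ JA sA) (Inc-pathEdge-start zero)
                   (edge≢pathEdge eA zero)

      M₂-first : M₂ (pathEdge zero) ≡ true
      M₂-first = not-injective {y = true} (trans (sym (PathParity.lastPathEdge pm₂))
        (matched-elsewhere⇒unmatched G pm₂ M₂eB (Inc-x″ JB sB) (Inc-pathEdge-end L) (edge≢pathEdge eB L)))

      parity₁ : fold false not (toℕ j) ≡ false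
      parity₁ = begin
        fold false not (toℕ j)               ≡⟨ cong (λ b → fold b not (toℕ j)) M₁-first ⟨
        fold (M₁ (pathEdge zero)) not (toℕ j) ≡⟨ PathParity.pathEdge-parity pm₁ j ⟨
        M₁ (pathEdge j)                       ≡⟨ avoids pm₁ ⟩
        false                                 ∎
        where open ≡-Reasoning

      parity₂ : fold false not (toℕ j) ≡ not false
      parity₂ = not-injective (begin
        not (fold false not (toℕ j))          ≡⟨ fold-not-not (toℕ j) false ⟨
        fold true not (toℕ j)                 ≡⟨ cong (λ b → fold b not (toℕ j)) M₂-first ⟨
        fold (M₂ (pathEdge zero)) not (toℕ j) ≡⟨ PathParity.pathEdge-parity pm₂ j ⟨
        M₂ (pathEdge j)                       ≡⟨ avoids pm₂ ⟩
        false                                 ∎)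
        where open ≡-Reasoning

  Reach-collapse : ∀ {S p q} → Reach G (withPath S) p q → Reach H S (collapse p) (collapse q)
  Reach-collapse here = here
  Reach-collapse {S} (step f s J r) with edgeView f
  ... | hEdge e with Joins-edge⁻ J
  ...   | u , v , JH , refl , refl =
          step e (withPath-edge⁻ s) (subst₂ (Joins H e) (sym (collapse-rep v u)) (sym (collapse-rep u v)) JH)
               (Reach-collapse r)
  Reach-collapse {S} (step f s J r) | pEdge j with Joins-pathEdge⁻ J
  ... | inj₁ (refl , refl) = subst (λ c → Reach H S c _) (trans (collapse-w (suc j)) (sym (collapse-w (inject₁ j))))
                                   (Reach-collapse r)
  ... | inj₂ (refl , refl) = subst (λ c → Reach H S c _) (trans (collapse-w (inject₁ j)) (sym (collapse-w (suc j))))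
                                   (Reach-collapse r)

  expand-reflects-MatchingCoveredSub : ∀ {S} → 2 ≤ n H →
    MatchingCoveredSub G (withPath S) → MatchingCoveredSub H S
  expand-reflects-MatchingCoveredSub {S} 2≤n (conn , _ , cov) = connected , 2≤n , covered
    where
      connected : Connected H S
      connected u v = subst₂ (Reach H S) (collapse-old u) (collapse-old v)
                        (Reach-collapse (conn (u ↑ˡ pathLen k) (v ↑ˡ pathLen k)))

      covered : ∀ e → S e → ∃[ M ] (IsPerfectMatching H S M × M e ≡ true)
      covered e s with cov (edge e) (withPath-edge⁺ s)
      ... | M , pm , Me = M ∘ edge , restrict-perfect pm , Me

  module _ {S : EdgeSet H} where

    Reach-path : ∀ i → Reach G (withPath S) x′ (w i)
    Reach-path = Reach-walk G (pathLen k) w (λ j → step (pathEdge j) (withPath-pathEdge j) (Joins-pathEdge j) here)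

    Reach-rep : ∀ o u → Reach G (withPath S) (u ↑ˡ pathLen k) (rep o u)
    Reach-rep o u with repView o u
    ... | rep-old _ r = subst (Reach G _ _) (sym r) here
    ... | rep-x′ refl _ r = subst (Reach G _ _) (sym r) here
    ... | rep-x″ refl _ r = subst (Reach G _ _) (sym r) (Reach-path (suc L))

    Reach-lift : ∀ {u v} → Reach H S u v → Reach G (withPath S) (u ↑ˡ pathLen k) (v ↑ˡ pathLen k)
    Reach-lift here = here
    Reach-lift (step {u} {v} e s J r) =
      Reach-trans G (Reach-rep v u)
        (step (edge e) (withPath-edge⁺ s) (Joins-edge J) (Reach-trans G (Reach-sym G (Reach-rep u v)) (Reach-lift r)))

  expand-preserves-MatchingCoveredSub : Loopless H → ∀ {S} → SideEdge S true → SideEdge S false →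
    MatchingCoveredSub H S → MatchingCoveredSub G (withPath S)
  expand-preserves-MatchingCoveredSub loopless {S} (eA , a , sA , JA , tA) (eB , b , sB , JB , tB) (conn , _ , cov) =
    connected , ≤-trans (s≤s (s≤s z≤n)) (m≤n+m (pathLen k) (n H)) , covered
    where
      toX′ : ∀ p → Reach G (withPath S) p x′
      toX′ p with vertexView p
      ... | old u  = Reach-lift (conn u x)
      ... | path j = Reach-sym G (Reach-path (suc j))

      connected : Connected G (withPath S)
      connected p q = Reach-trans G (toX′ p) (Reach-sym G (toX′ q))

      extend : ∀ {e₀ o₀} → S e₀ → Joins H e₀ x o₀ →
        ∃[ M ] (IsPerfectMatching G (withPath S) M × (∀ j → M (pathEdge j) ≡ fold (not (side o₀)) not (toℕ j)))
      extend s J with cov _ s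
      ... | Mh , pmh , Me = let open Extension loopless pmh Me J in M , perfect , M-pathEdge

      covered : ∀ f → withPath S f → ∃[ M ] (IsPerfectMatching G (withPath S) M × M f ≡ true)
      covered f s with edgeView f
      ... | hEdge e with cov e (withPath-edge⁻ s)
      ...   | Mh , pmh , Me with proj₁ (proj₂ pmh) x
      ...     | e₀ , Me₀ , i₀ with Inc⇒Joins H i₀
      ...       | o₀ , J₀ = let open Extension loopless pmh Me₀ J₀ in M , perfect , trans (M-edge e) Me
      covered f s | pEdge j with fold false not (toℕ j) in parity
      ... | true with extend sA JA
      ...   | M , pm , Mpath = M , pm , trans (Mpath j) (trans (cong (λ b → fold (not b) not (toℕ j)) tA) parity)
      covered f s | pEdge j | false with extend sB JB
      ...   | M , pm , Mpath = M , pm , trans (Mpath j)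
              (trans (cong (λ b → fold (not b) not (toℕ j)) tB) (trans (fold-not-not (toℕ j) false) (cong not parity)))

  Adj-collapse : ∀ {p q} → Adj G p q → Adj H (collapse p) (collapse q) ⊎ (collapse p ≡ x × collapse q ≡ x)
  Adj-collapse (f , J) with edgeView f
  ... | hEdge e with Joins-edge⁻ J
  ...   | u , v , JH , refl , refl = inj₁ (e , subst₂ (Joins H e) (sym (collapse-rep v u)) (sym (collapse-rep u v)) JH)
  Adj-collapse (f , J) | pEdge j with Joins-pathEdge⁻ J
  ... | inj₁ (refl , refl) = inj₂ (collapse-w (inject₁ j) , collapse-w (suc j))
  ... | inj₂ (refl , refl) = inj₂ (collapse-w (suc j) , collapse-w (inject₁ j))

  Adj-old : ∀ {a b} → a ≢ x → b ≢ x → Adj H a b → Adj G (a ↑ˡ pathLen k) (b ↑ˡ pathLen k)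
  Adj-old {a} {b} a≢x b≢x (e , J) = edge e , subst₂ (Joins G (edge e)) (rep-≢x b a≢x) (rep-≢x a b≢x) (Joins-edge J)

  -- The G-neighbours of an old vertex u ≠ x are the images of its H-neighbours h;
  -- the image of x is x′ or x″ according to the side of u.
  LiftedNeighbour : Fin (n H) → Fin V′ → Set
  LiftedNeighbour u q = ∃[ h ] (Adj H u h ×
    ((q ≡ h ↑ˡ pathLen k × (h ≡ x → side u ≡ true)) ⊎ (h ≡ x × q ≡ x″ × side u ≡ false)))

  liftedNeighbour : ∀ {u q} → u ≢ x → Adj G (u ↑ˡ pathLen k) q → LiftedNeighbour u q
  liftedNeighbour {u} u≢x (f , J) with edgeView f
  ... | hEdge e with Joins-edge⁻ J
  ...   | u′ , v , JH , eq , eq′ with rep≡old {v} {u′} {u} (sym eq)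
  ...     | refl , _ with repView u v
  ...       | rep-old v≢x r = v , (e , JH) , inj₁ (trans eq′ r , ⊥-elim ∘ v≢x)
  ...       | rep-x′ refl s r = x , (e , JH) , inj₁ (trans eq′ r , λ _ → s)
  ...       | rep-x″ refl s r = x , (e , JH) , inj₂ (refl , trans eq′ r , s)
  liftedNeighbour {u} u≢x (f , J) | pEdge j with Joins-pathEdge⁻ J
  ... | inj₁ (eq , _) = ⊥-elim (u≢x (proj₂ (w≡old {inject₁ j} (sym eq))))
  ... | inj₂ (eq , _) = ⊥-elim (u≢x (proj₂ (w≡old {suc j} (sym eq))))

  LiftedNeighbour-≢ : ∀ {u q₁ q₂} (N₁ : LiftedNeighbour u q₁) (N₂ : LiftedNeighbour u q₂) →
                      q₁ ≢ q₂ → proj₁ N₁ ≢ proj₁ N₂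
  LiftedNeighbour-≢ (_ , _ , inj₁ (r₁ , _)) (_ , _ , inj₁ (r₂ , _)) q₁≢q₂ eq =
    q₁≢q₂ (trans r₁ (trans (cong (_↑ˡ pathLen k) eq) (sym r₂)))
  LiftedNeighbour-≢ (_ , _ , inj₁ (_ , s₁)) (_ , _ , inj₂ (h≡x , _ , s)) _ eq = not-¬ (s₁ (trans eq h≡x)) s
  LiftedNeighbour-≢ (_ , _ , inj₂ (h≡x , _ , s)) (_ , _ , inj₁ (_ , s₂)) _ eq = not-¬ (s₂ (trans (sym eq) h≡x)) s
  LiftedNeighbour-≢ (_ , _ , inj₂ (_ , r₁ , _)) (_ , _ , inj₂ (_ , r₂ , _)) q₁≢q₂ _ =
    q₁≢q₂ (trans r₁ (sym r₂))

  OldOnSide : Bool → Fin V′ → Set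
  OldOnSide b q = ∃[ v ] (v ≢ x × q ≡ v ↑ˡ pathLen k × Adj H x v × side v ≡ b)

  module _ (loopless : Loopless H) where

    Adj-x′ : ∀ {b} → Adj H x b → side b ≡ true → Adj G x′ (b ↑ˡ pathLen k)
    Adj-x′ {b} (e , J) s = edge e ,
      subst₂ (Joins G (edge e)) (rep-x-true s) (rep-≢x x (Adj-irrefl H loopless (e , J) ∘ sym)) (Joins-edge J)

    Adj-x″ : ∀ {b} → Adj H x b → side b ≡ false → Adj G x″ (b ↑ˡ pathLen k)
    Adj-x″ {b} (e , J) s = edge e ,
      subst₂ (Joins G (edge e)) (rep-x-false s) (rep-≢x x (Adj-irrefl H loopless (e , J) ∘ sym)) (Joins-edge J)

    neighbour-x′ : ∀ {q} → Adj G x′ q → q ≡ n H ↑ʳ zero ⊎ OldOnSide true q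
    neighbour-x′ {q} (f , J) with edgeView f
    ... | hEdge e with Joins-edge⁻ J
    ...   | u , v , JH , eq , eq′ with rep≡old {v} {u} {x} (sym eq)
    ...     | refl , s = inj₂ (v , v≢x , trans eq′ (rep-≢x x v≢x) , (e , JH) , s refl)
      where v≢x = Joins-irrefl H loopless JH ∘ sym
    neighbour-x′ {q} (f , J) | pEdge j with Joins-pathEdge⁻ J
    ... | inj₁ (eq , eq′) with inject₁≡zero⇒≡zero j (proj₁ (w≡old {inject₁ j} (sym eq)))
    ...   | refl = inj₁ eq′
    neighbour-x′ {q} (f , J) | pEdge j | inj₂ (eq , _) with proj₁ (w≡old {suc j} (sym eq))
    ... | ()

    neighbour-path : ∀ {j q} → Adj G (n H ↑ʳ j) q →
      q ≡ w (inject₁ j) ⊎ (∃[ i ] (j ≡ inject₁ i × q ≡ w (suc (suc i)))) ⊎ (j ≡ L × OldOnSide false q)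
    neighbour-path {j} {q} (f , J) with edgeView f
    ... | hEdge e with Joins-edge⁻ J
    ...   | u , v , JH , eq , eq′ with rep≡path {v} {u} {j} (sym eq)
    ...     | refl , s , j≡L = inj₂ (inj₂ (j≡L , v , v≢x , trans eq′ (rep-≢x x v≢x) , (e , JH) , s))
      where v≢x = Joins-irrefl H loopless JH ∘ sym
    neighbour-path {j} {q} (f , J) | pEdge i with Joins-pathEdge⁻ J
    neighbour-path {j} {q} (f , J) | pEdge zero    | inj₁ (eq , _) = ⊥-elim (↑ˡ≢↑ʳ x j (sym eq))
    neighbour-path {j} {q} (f , J) | pEdge (suc i) | inj₁ (eq , eq′) =
      inj₂ (inj₁ (i , ↑ʳ-injective (n H) j _ eq , eq′))
    neighbour-path {j} {q} (f , J) | pEdge i | inj₂ (eq , eq′) with suc-injective (w≡path {suc i} {j} (sym eq))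
    ... | refl = inj₁ eq′

  private
    OnSide : Bool → Fin (n H) → Set
    OnSide b a = Adj H x a × side a ≡ b

    onSide : ∀ {a} → Adj H x a → OnSide true a ⊎ OnSide false a
    onSide {a} xa with side a
    ... | true  = inj₁ (xa , refl)
    ... | false = inj₂ (xa , refl)

  expand-reflects-ClawFree : BisimplicialWith H x side → ClawFree G → ClawFree H
  expand-reflects-ClawFree (clique , _) cfG c a₁ a₂ a₃
    (c≢₁ , c≢₂ , c≢₃ , d₁₂ , d₁₃ , d₂₃ , A₁ , A₂ , A₃ , n₁₂ , n₁₃ , n₂₃)
    with c ≟ x
  ... | yes refl = three-in-two-classes (OnSide true) (OnSide false) (Independent H)
                     sameClique sameClique (d₁₂ , n₁₂) (d₁₃ , n₁₃) (d₂₃ , n₂₃)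
                     (onSide A₁) (onSide A₂) (onSide A₃)
    where
      sameClique : ∀ {b a a′} → OnSide b a → OnSide b a′ → ¬ Independent H a a′
      sameClique (xa , sa) (xa′ , sa′) (a≢a′ , ¬adj) = ¬adj (clique _ _ xa xa′ a≢a′ (trans sa (sym sa′)))
  ... | no c≢x = cfG (c ↑ˡ pathLen k) (rep c a₁) (rep c a₂) (rep c a₃)
        (centre c≢₁ , centre c≢₂ , centre c≢₃ , distinct d₁₂ , distinct d₁₃ , distinct d₂₃ ,
         adjacent A₁ , adjacent A₂ , adjacent A₃ ,
         nonadjacent d₁₂ n₁₂ , nonadjacent d₁₃ n₁₃ , nonadjacent d₂₃ n₂₃)
    where
      centre : ∀ {a} → c ≢ a → c ↑ˡ pathLen k ≢ rep c a
      centre {a} c≢a eq = c≢a (sym (proj₁ (rep≡old {c} {a} {c} (sym eq))))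

      distinct : ∀ {a b} → a ≢ b → rep c a ≢ rep c b
      distinct a≢b = a≢b ∘ rep-injective

      adjacent : ∀ {a} → Adj H c a → Adj G (c ↑ˡ pathLen k) (rep c a)
      adjacent {a} (e , J) = edge e , subst (λ p → Joins G (edge e) p (rep c a)) (rep-≢x a c≢x) (Joins-edge J)

      nonadjacent : ∀ {a b} → a ≢ b → ¬ Adj H a b → ¬ Adj G (rep c a) (rep c b)
      nonadjacent {a} {b} a≢b ¬adj adj with Adj-collapse adj
      ... | inj₁ h = ¬adj (subst₂ (Adj H) (collapse-rep c a) (collapse-rep c b) h)
      ... | inj₂ (a≡x , b≡x) = a≢b (trans (sym (collapse-rep c a)) (trans a≡x (trans (sym b≡x) (collapse-rep c b))))

  module _ (loopless : Loopless H) (bis : BisimplicialWith H x side) where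
    private
      clique = proj₁ bis
      noCrossEdges = proj₁ (proj₂ bis)

      twoOnSide : ∀ b → ∃[ u ] ∃[ v ] (u ≢ v × Adj H x u × Adj H x v × side u ≡ b × side v ≡ b)
      twoOnSide true  = proj₁ (proj₂ (proj₂ bis))
      twoOnSide false = proj₂ (proj₂ (proj₂ bis))

    2≤n : 2 ≤ n H
    2≤n with twoOnSide true
    ... | u , _ , _ , xu , _ = distinct⇒2≤ x u (Adj-irrefl H loopless xu)

    SideEdge-all : ∀ b → SideEdge (λ _ → ⊤) b
    SideEdge-all b with twoOnSide b
    ... | u , _ , _ , (e , J) , _ , s , _ = e , u , tt , J , s

    -- Each side has two neighbours of x, and deleting one edge cannot cut x off from both.
    SideEdge-avoiding : ∀ e b → SideEdge (λ f → f ≢ e) b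
    SideEdge-avoiding e b with twoOnSide b
    ... | u , v , u≢v , (eu , Ju) , (ev , Jv) , su , sv with eu ≟ e | ev ≟ e
    ...   | no eu≢e | _        = eu , u , eu≢e , Ju , su
    ...   | yes _   | no ev≢e  = ev , v , ev≢e , Jv , sv
    ...   | yes refl | yes refl = ⊥-elim (u≢v (Joins-functional H loopless Ju Jv))

    adjacent-neighbours-sameSide : ∀ {u h} → Adj H x u → Adj H x h → Adj H u h → side h ≡ side u
    adjacent-neighbours-sameSide {u} {h} xu xh uh with side h ≟ᵇ side u
    ... | yes eq = eq
    ... | no ne = ⊥-elim (noCrossEdges u h xu xh (ne ∘ sym) uh)

    LiftedNeighbour-Adj : ∀ {u q₁ q₂} (N₁ : LiftedNeighbour u q₁) (N₂ : LiftedNeighbour u q₂) →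
                          Adj H (proj₁ N₁) (proj₁ N₂) → Adj G q₁ q₂
    LiftedNeighbour-Adj (h₁ , uh₁ , inj₁ (refl , s₁)) (h₂ , uh₂ , inj₁ (refl , s₂)) a₁₂
      with h₁ ≟ x | h₂ ≟ x
    ... | no h₁≢x | no h₂≢x = Adj-old h₁≢x h₂≢x a₁₂
    ... | yes refl | _ =
      Adj-x′ loopless a₁₂ (trans (adjacent-neighbours-sameSide (Adj-sym H uh₁) a₁₂ uh₂) (s₁ refl))
    ... | no _ | yes refl = Adj-sym G (Adj-x′ loopless (Adj-sym H a₁₂)
          (trans (adjacent-neighbours-sameSide (Adj-sym H uh₂) (Adj-sym H a₁₂) uh₁) (s₂ refl)))
    LiftedNeighbour-Adj (h₁ , uh₁ , inj₁ (refl , _)) (h₂ , uh₂ , inj₂ (refl , refl , s)) a₁₂ =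
      Adj-sym G (Adj-x″ loopless (Adj-sym H a₁₂)
        (trans (adjacent-neighbours-sameSide (Adj-sym H uh₂) (Adj-sym H a₁₂) uh₁) s))
    LiftedNeighbour-Adj (h₁ , uh₁ , inj₂ (refl , refl , s)) (h₂ , uh₂ , inj₁ (refl , _)) a₁₂ =
      Adj-x″ loopless a₁₂ (trans (adjacent-neighbours-sameSide (Adj-sym H uh₁) a₁₂ uh₂) s)
    LiftedNeighbour-Adj (_ , _ , inj₂ (refl , _ , _)) (_ , _ , inj₂ (refl , _ , _)) a₁₂ =
      ⊥-elim (Adj-irrefl H loopless a₁₂ refl)

    OldOnSide-clique : ∀ {b q q′} → OldOnSide b q → OldOnSide b q′ → ¬ Independent G q q′
    OldOnSide-clique (v , v≢x , refl , xv , sv) (v′ , v′≢x , refl , xv′ , sv′) (q≢q′ , ¬adj) =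
      ¬adj (Adj-old v≢x v′≢x (clique _ _ xv xv′ (q≢q′ ∘ cong (_↑ˡ pathLen k)) (trans sv (sym sv′))))

    expand-preserves-ClawFree : ClawFree H → ClawFree G
    expand-preserves-ClawFree cfH c a₁ a₂ a₃
      (c≢₁ , c≢₂ , c≢₃ , d₁₂ , d₁₃ , d₂₃ , A₁ , A₂ , A₃ , n₁₂ , n₁₃ , n₂₃)
      with vertexView c
    ... | old u with u ≟ x
    ...   | yes refl = three-in-two-classes (_≡ n H ↑ʳ zero) (OldOnSide true) (Independent G)
            (λ p p′ (q≢q′ , _) → q≢q′ (trans p (sym p′))) OldOnSide-clique
            (d₁₂ , n₁₂) (d₁₃ , n₁₃) (d₂₃ , n₂₃)
            (neighbour-x′ loopless A₁) (neighbour-x′ loopless A₂) (neighbour-x′ loopless A₃)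
    ...   | no u≢x with liftedNeighbour u≢x A₁ | liftedNeighbour u≢x A₂ | liftedNeighbour u≢x A₃
    ...     | N₁ | N₂ | N₃ = cfH u (proj₁ N₁) (proj₁ N₂) (proj₁ N₃)
              (Adj-irrefl H loopless (proj₁ (proj₂ N₁)) , Adj-irrefl H loopless (proj₁ (proj₂ N₂)) ,
               Adj-irrefl H loopless (proj₁ (proj₂ N₃)) ,
               LiftedNeighbour-≢ N₁ N₂ d₁₂ , LiftedNeighbour-≢ N₁ N₃ d₁₃ ,
               LiftedNeighbour-≢ N₂ N₃ d₂₃ ,
               proj₁ (proj₂ N₁) , proj₁ (proj₂ N₂) , proj₁ (proj₂ N₃) ,
               n₁₂ ∘ LiftedNeighbour-Adj N₁ N₂ , n₁₃ ∘ LiftedNeighbour-Adj N₁ N₃ ,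
               n₂₃ ∘ LiftedNeighbour-Adj N₂ N₃)
    expand-preserves-ClawFree cfH c a₁ a₂ a₃
      (c≢₁ , c≢₂ , c≢₃ , d₁₂ , d₁₃ , d₂₃ , A₁ , A₂ , A₃ , n₁₂ , n₁₃ , n₂₃)
      | path j = three-in-two-classes (_≡ w (inject₁ j)) Ahead (Independent G)
          (λ p p′ (q≢q′ , _) → q≢q′ (trans p (sym p′))) ahead-clique
          (d₁₂ , n₁₂) (d₁₃ , n₁₃) (d₂₃ , n₂₃)
          (neighbour-path loopless A₁) (neighbour-path loopless A₂) (neighbour-path loopless A₃)
      where
        Ahead : Fin V′ → Set
        Ahead q = (∃[ i ] (j ≡ inject₁ i × q ≡ w (suc (suc i)))) ⊎ (j ≡ L × OldOnSide false q)

        ahead-clique : ∀ {q q′} → Ahead q → Ahead q′ → ¬ Independent G q q′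
        ahead-clique (inj₁ (i , j≡ , r)) (inj₁ (i′ , j≡′ , r′)) (q≢q′ , _)
          with inject₁-injective (trans (sym j≡) j≡′)
        ... | refl = q≢q′ (trans r (sym r′))
        ahead-clique (inj₁ (_ , j≡ , _)) (inj₂ (j≡L , _)) _ = fromℕ≢inject₁ (trans (sym j≡L) j≡)
        ahead-clique (inj₂ (j≡L , _)) (inj₁ (_ , j≡ , _)) _ = fromℕ≢inject₁ (trans (sym j≡L) j≡)
        ahead-clique (inj₂ (_ , o)) (inj₂ (_ , o′)) = OldOnSide-clique o o′

lemma3p3 : (H : Graph) → Loopless H → (x : Fin (n H)) → (side : Fin (n H) → Bool) →
    BisimplicialWith H x side → (k : ℕ) →
    ((ClawFree (expand H x side k) × MatchingCovered (expand H x side k))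
      ⇔ (ClawFree H × MatchingCovered H))
    × ((ClawFree (expand H x side k) × MatchingCovered (expand H x side k)) →
        ((e : Fin (m H)) → Removable (expand H x side k) (e ↑ˡ pathLen k) ⇔ Removable H e)
        × ((j : Fin (pathLen k)) → ¬ Removable (expand H x side k) (m H ↑ʳ j)))
lemma3p3 H loopless x side bis k =
  mk⇔ (λ (cf , mc) → expand-reflects-ClawFree bis cf , matchingCovered⁻ mc)
      (λ (cf , mc) → expand-preserves-ClawFree loopless bis cf , matchingCovered⁺ mc) ,
  λ _ → (λ e → mk⇔ (removable⁻ e) (removable⁺ e)) ,
        pathEdge-notRemovable (SideEdge-all loopless bis true) (SideEdge-all loopless bis false)
  where
    open Expansion H x side k using (G; edge)
    open Expanded H x side k

    matchingCovered⁻ : MatchingCovered G → MatchingCovered H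
    matchingCovered⁻ = expand-reflects-MatchingCoveredSub (2≤n loopless bis)
                     ∘ MatchingCoveredSub-cong G (λ f _ → withPath-all f) (λ _ _ → tt)

    matchingCovered⁺ : MatchingCovered H → MatchingCovered G
    matchingCovered⁺ = MatchingCoveredSub-cong G (λ _ _ → tt) (λ f _ → withPath-all f)
                     ∘ expand-preserves-MatchingCoveredSub loopless (SideEdge-all loopless bis true)
                                                                    (SideEdge-all loopless bis false)

    removable⁻ : ∀ e → Removable G (edge e) → Removable H e
    removable⁻ e = expand-reflects-MatchingCoveredSub (2≤n loopless bis)
                 ∘ MatchingCoveredSub-cong G (withPath-avoiding⁺ e) (withPath-avoiding⁻ e)

    removable⁺ : ∀ e → Removable H e → Removable G (edge e)
    removable⁺ e = MatchingCoveredSub-cong G (withPath-avoiding⁻ e) (withPath-avoiding⁺ e)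
                 ∘ expand-preserves-MatchingCoveredSub loopless (SideEdge-avoiding loopless bis e true)
                                                                (SideEdge-avoiding loopless bis e false)
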